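{- Let $\mathcal{F}\subseteq 2^{[n]}$ be such that the vertex sets of the components of $G_\mathcal{F}$ are diamonds $\mathcal{F}_1,\dots,\mathcal{F}_\ell$. For $i,j\in\{0,\dots,n\}$ let $a_{i,j}$ be the number of these components whose bottom corner has size $i$ and whose top corner has size $i+j$. Then \[ \sum_{i=0}^n\sum_{j=0}^n\frac{a_{i,j}}{\binom{n-j}{i}}\le 1. \]
   Context: For $\mathcal{F}\subseteq 2^{[n]}$, $G_\mathcal{F}$ is the graph on $\mathcal{F}$ with distinct $A,B$ adjacent iff $A\subseteq B$ or $B\subseteq A$. A diamond is a family of the form $\{X: A\subseteq X\subseteq B\}$ for some $A\subseteq B\subseteq[n]$; $A$ is its bottom corner and $B$ its top corner. -}

module Defs where

open import Level using (0ℓ)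
open import Data.Nat using (ℕ; zero; suc; _+_; _∸_)
open import Data.Nat.Combinatorics using (_C_)
open import Data.Nat.Properties using (_≟_)
open import Data.Integer using (+_)
open import Data.Rational using (ℚ; 0ℚ; _/_) renaming (_+_ to _+ℚ_)
open import Data.Fin.Subset using (Subset; _⊆_; ∣_∣)
open import Data.List using (List; length; filter; upTo; foldr; map)
open import Data.Product using (_×_; ∃; ∃₂; proj₁; proj₂; _,_)
open import Data.Sum using (_⊎_)
open import Relation.Nullary using (¬_)
open import Relation.Nullary.Decidable using (_×-dec_)
open import Relation.Binary.PropositionalEquality using (_≡_)
open import Relation.Binary.Construct.Closure.ReflexiveTransitive using (Star)
open import Function.Bundles using (_⇔_)

Family : ℕ → Set₁
Family n = Subset n → Set

Adj : ∀ {n} → Family n → Subset n → Subset n → Set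
Adj F A B = F A × F B × ¬ (A ≡ B) × (A ⊆ B ⊎ B ⊆ A)

InComponent : ∀ {n} → Family n → Subset n → Subset n → Set
InComponent F A B = F A × F B × Star (Adj F) A B

InDiamond : ∀ {n} → Subset n → Subset n → Subset n → Set
InDiamond X Y Z = X ⊆ Z × Z ⊆ Y

ComponentIsDiamond : ∀ {n} → Family n → Subset n → Subset n → Subset n → Set
ComponentIsDiamond F A X Y = X ⊆ Y × (∀ Z → InComponent F A Z ⇔ InDiamond X Y Z)

AllComponentsDiamonds : ∀ {n} → Family n → Set
AllComponentsDiamonds {n} F = ∀ A → F A → ∃₂ λ (X Y : Subset n) → ComponentIsDiamond F A X Y

IsComponentCorners : ∀ {n} → Family n → Subset n → Subset n → Set
IsComponentCorners {n} F X Y = ∃ λ (A : Subset n) → F A × ComponentIsDiamond F A X Y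

-- a_{i,j} for an enumeration L of the corner pairs of the components:
-- number of components with |bottom| = i and |top| = i + j.
a : ∀ {n} → List (Subset n × Subset n) → ℕ → ℕ → ℕ
a L i j = length (filter (λ p → (∣ proj₁ p ∣ ≟ i) ×-dec (∣ proj₂ p ∣ ≟ i + j)) L)

-- k / m as a rational; by convention 0 when m = 0 (only occurs when k = 0 here).
frac : ℕ → ℕ → ℚ
frac k zero = 0ℚ
frac k (suc m) = (+ k) / suc m

sumℚ : ℕ → (ℕ → ℚ) → ℚ
sumℚ n f = foldr _+ℚ_ 0ℚ (map f (upTo (suc n)))

lhs : ∀ {n} → List (Subset n × Subset n) → ℚ
lhs {n} L = sumℚ n (λ i → sumℚ n (λ j → frac (a L i j) ((n ∸ j) C i)))

-- A maximal chain of 2^[n] is an ordering of the n coordinates, and it meets the diamond [X, Y] iff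
-- every coordinate of X comes before every coordinate outside Y. Calling the coordinates of X "below",
-- those of Y ∖ X "inside" and the others "above", a diamond with |X| = i and |Y| = i + j is met by
-- n! / C(n − j, i) chains. For two distinct components [X, Y] and [X′, Y′] we have X ⊈ Y′ and X′ ⊈ Y,
-- since otherwise they would be joined by an edge; so some coordinate is below one diamond and above the
-- other and vice versa, and no chain meets both. Hence Σ a_{i,j} n! / C(n − j, i) ≤ n!. The disjointness
-- count is done by induction on n, sorting the chains by the coordinate they add last.
module Submission where

open import Data.Bool using (Bool; true; false)
import Data.Bool.Properties as Bool
open import Data.Fin using (Fin; zero; suc; punchOut)
open import Data.Fin.Properties using (punchIn-punchOut; ¬∀⟶∃¬)
open import Data.Fin.Subset as Subset using (Subset; _⊆_; ∣_∣)
open import Data.Fin.Subset.Properties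
  using (_∈?_; ⊆-refl; ⊆-antisym; drop-∷-⊆; ∣p∣≤n; p⊆q⇒∣p∣≤∣q∣)
open import Data.Integer as ℤ using (ℤ; +_)
import Data.Integer.Properties as ℤ
open import Data.Integer.Tactic.RingSolver using () renaming (solve-∀ to ℤ-solve-∀)
open import Data.List using (List; []; _∷_; [_]; map; foldr; upTo; applyUpTo; length; filter)
open import Data.List.Membership.Propositional using (_∈_)
open import Data.List.Properties
  using (map-cong; map-cong-local; map-∘; map-applyUpTo; length-++; filter-++; filter-accept; filter-reject; filter-none)
open import Data.List.Relation.Unary.All as All using (All; []; _∷_)
open import Data.List.Relation.Unary.AllPairs using (AllPairs; []; _∷_)
open import Data.List.Relation.Unary.AllPairs.Properties using (map⁺)
open import Data.List.Relation.Unary.Unique.Propositional using (Unique)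
open import Data.Nat
  using (ℕ; zero; suc; _+_; _*_; _∸_; _≤_; _<_; _≤?_; _!; NonZero; ≢-nonZero⁻¹; z≤n; s≤s)
open import Data.Nat.Combinatorics using (_C_; k![n∸k]!∣n!; nCk+nC[k+1]≡[n+1]C[k+1])
open import Data.Nat.Combinatorics.Specification using (nCk≡n!/k![n-k]!)
open import Data.Nat.DivMod as ℕ using (m/n*n≡m)
open import Data.Nat.ListAction using (sum)
open import Data.Nat.Properties
open import Algebra.Properties.CommutativeMonoid.Sum +-0-commutativeMonoid
  using (sum-syntax; sum-remove; ∑-distrib-+; sum-replicate-zero; sum-cong-≗)
open import Algebra.Properties.CommutativeSemigroup +-commutativeSemigroup using (interchange)
open import Data.Nat.Tactic.RingSolver using (solve-∀)
open import Data.Product using (∃; _×_; _,_; proj₁; proj₂; uncurry)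
open import Data.Rational as ℚ using (ℚ; 0ℚ; 1ℚ; _/_; toℚᵘ)
import Data.Rational.Properties as ℚ
open import Data.Rational.Unnormalised as ℚᵘ using (mkℚᵘ; *≡*; *≤*)
import Data.Rational.Unnormalised.Properties as ℚᵘ
open import Data.Sum using (inj₁) renaming (swap to ⊎-swap)
open import Data.Vec using (_∷_; []; lookup; here)
open import Data.Vec.Functional using (removeAt)
open import Data.Vec.Properties using (≡-dec; []=⇒lookup; lookup⇒[]=)
open import Function using (_∘_; id)
open import Function.Bundles using (Equivalence; _⇔_)
open import Relation.Binary.Construct.Closure.ReflexiveTransitive using (Star; ε; _◅_; _◅◅_; reverse)
open import Relation.Binary.PropositionalEquality
  using (_≡_; _≢_; refl; sym; trans; cong; cong₂; subst; subst₂; module ≡-Reasoning)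
open import Relation.Nullary using (¬_; contradiction; Dec; yes; no)
open import Relation.Nullary.Decidable using (_×-dec_; _→-dec_)
open import Defs

sum-map-+ : ∀ {A : Set} (f g : A → ℕ) xs → sum (map (λ x → f x + g x) xs) ≡ sum (map f xs) + sum (map g xs)
sum-map-+ f g []       = refl
sum-map-+ f g (x ∷ xs) = trans (cong (_+_ (f x + g x)) (sum-map-+ f g xs)) (interchange (f x) (g x) _ _)

sum-∑-comm : ∀ {A : Set} {n} (f : Fin n → A → ℕ) xs →
  sum (map (λ x → ∑[ p < n ] f p x) xs) ≡ ∑[ p < n ] sum (map (f p) xs)
sum-∑-comm {n = n} f []       = sym (sum-replicate-zero n)
sum-∑-comm         f (x ∷ xs) =
  trans (cong (_+_ (∑[ p < _ ] f p x)) (sum-∑-comm f xs))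
        (sym (∑-distrib-+ (λ p → f p x) (λ p → sum (map (f p) xs))))

∑-≤-* : ∀ {n} {f : Fin n → ℕ} {c} → (∀ p → f p ≤ c) → ∑[ p < n ] f p ≤ n * c
∑-≤-* {zero}  f≤c = z≤n
∑-≤-* {suc n} f≤c = +-mono-≤ (f≤c zero) (∑-≤-* (f≤c ∘ suc))

sum-applyUpTo-zero : ∀ {f : ℕ → ℕ} m → (∀ i → f i ≡ 0) → sum (applyUpTo f m) ≡ 0
sum-applyUpTo-zero zero    f≡0 = refl
sum-applyUpTo-zero (suc m) f≡0 = cong₂ _+_ (f≡0 0) (sum-applyUpTo-zero m (f≡0 ∘ suc))

sum-applyUpTo-single : ∀ {f : ℕ → ℕ} {i₀} m → i₀ < m → (∀ i → i ≢ i₀ → f i ≡ 0) →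
  sum (applyUpTo f m) ≡ f i₀
sum-applyUpTo-single {f} {zero}   (suc m) _          vanish =
  trans (cong (_+_ (f 0)) (sum-applyUpTo-zero m (λ i → vanish (suc i) λ ()))) (+-identityʳ (f 0))
sum-applyUpTo-single {f} {suc i₀} (suc m) (s≤s i₀<m) vanish =
  cong₂ _+_ (vanish 0 λ ())
            (sum-applyUpTo-single m i₀<m (λ i i≢i₀ → vanish (suc i) (i≢i₀ ∘ suc-injective)))

AllPairs-map-All : ∀ {A : Set} {P : A → Set} {R S : A → A → Set} →
  (∀ {x y} → P x → P y → R x y → S x y) → ∀ {xs} → All P xs → AllPairs R xs → AllPairs S xs
AllPairs-map-All f []         []         = []
AllPairs-map-All f (px ∷ pxs) (rxs ∷ rs) =
  All.zipWith (λ (py , r) → f px py r) (pxs , rxs) ∷ AllPairs-map-All f pxs rs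

binomial*factorials : ∀ m n → ((m + n) C m) * (m ! * n !) ≡ (m + n) !
binomial*factorials m n = begin
  ((m + n) C m) * (m ! * n !)
    ≡⟨ cong (λ k → ((m + n) C m) * (m ! * k !)) (m+n∸m≡n m n) ⟨
  ((m + n) C m) * (m ! * (m + n ∸ m) !)
    ≡⟨ cong (_* (m ! * (m + n ∸ m) !)) (nCk≡n!/k![n-k]! (m≤m+n m n)) ⟩
  (m + n) ! ℕ./ (m ! * (m + n ∸ m) !) * (m ! * (m + n ∸ m) !)
    ≡⟨ m/n*n≡m (k![n∸k]!∣n! (m≤m+n m n)) ⟩
  (m + n) ! ∎
  where
  open ≡-Reasoning
  instance _ = m !* (m + n ∸ m) !≢0

binomial-nonZero : ∀ m n → NonZero ((m + n) C m)
binomial-nonZero m n with (m + n) C m | binomial*factorials m n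
... | zero  | 0≡[m+n]! = contradiction (sym 0≡[m+n]!) (≢-nonZero⁻¹ _ {{(m + n) !≢0}})
... | suc _ | _        = _

-- Orderings of i + k + j coordinates in which the i below ones precede the k above ones: place and
-- order the j inside ones, then order the below ones and the above ones separately.
chainCount : ℕ → ℕ → ℕ → ℕ
chainCount i j k = ((i + k + j) C j) * (j ! * (i ! * k !))

chainCount*binomial : ∀ i j k → chainCount i j k * ((i + k) C i) ≡ (i + k + j) !
chainCount*binomial i j k = begin
  ((i + k + j) C j) * (j ! * (i ! * k !)) * ((i + k) C i)
    ≡⟨ regroup ((i + k + j) C j) (j !) (i !) (k !) ((i + k) C i) ⟩
  ((i + k + j) C j) * (j ! * (((i + k) C i) * (i ! * k !)))
    ≡⟨ cong (λ x → ((i + k + j) C j) * (j ! * x)) (binomial*factorials i k) ⟩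
  ((i + k + j) C j) * (j ! * (i + k) !)
    ≡⟨ cong (λ x → (x C j) * (j ! * (i + k) !)) (+-comm (i + k) j) ⟩
  ((j + (i + k)) C j) * (j ! * (i + k) !)
    ≡⟨ binomial*factorials j (i + k) ⟩
  (j + (i + k)) !
    ≡⟨ cong _! (+-comm j (i + k)) ⟩
  (i + k + j) ! ∎
  where
  open ≡-Reasoning
  regroup : ∀ c f g h b → c * (f * (g * h)) * b ≡ c * (f * (b * (g * h)))
  regroup = solve-∀

chainCount≤factorial : ∀ i j k → chainCount i j k ≤ (i + k + j) !
chainCount≤factorial i j k = begin
  chainCount i j k                  ≤⟨ m≤m*n (chainCount i j k) ((i + k) C i) {{binomial-nonZero i k}} ⟩
  chainCount i j k * ((i + k) C i)  ≡⟨ chainCount*binomial i j k ⟩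
  (i + k + j) !                     ∎
  where open ≤-Reasoning

chainCount-recurrence : ∀ i j k →
  chainCount i j (suc k) ≡ j * chainCount i (j ∸ 1) (suc k) + suc k * chainCount i j k
chainCount-recurrence i zero    k = ring-identity (i !) (k !) k
  where
  ring-identity : ∀ a b k → 1 * (1 * (a * (b + k * b))) ≡ 0 + (1 + k) * (1 * (1 * (a * b)))
  ring-identity = solve-∀
chainCount-recurrence i (suc j) k = begin
  ((i + suc k + suc j) C suc j) * (suc j ! * (i ! * suc k !))
    ≡⟨ cong (λ x → (x C suc j) * (suc j ! * (i ! * suc k !))) (+-suc (i + suc k) j) ⟩
  (suc M C suc j) * (suc j ! * (i ! * suc k !))
    ≡⟨ cong (_* (suc j ! * (i ! * suc k !))) (nCk+nC[k+1]≡[n+1]C[k+1] M j) ⟨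
  (M C j + M C suc j) * (suc j ! * (i ! * suc k !))
    ≡⟨ pascal (M C j) (M C suc j) (j !) (i !) (k !) j k ⟩
  suc j * ((M C j) * (j ! * (i ! * suc k !))) + suc k * ((M C suc j) * (suc j ! * (i ! * k !)))
    ≡⟨ cong (λ x → suc j * chainCount i j (suc k) + suc k * ((x C suc j) * (suc j ! * (i ! * k !)))) i+k+1+j≡M ⟨
  suc j * chainCount i j (suc k) + suc k * chainCount i (suc j) k ∎
  where
  open ≡-Reasoning
  M = i + suc k + j
  i+k+1+j≡M : i + k + suc j ≡ M
  i+k+1+j≡M = trans (+-suc (i + k) j) (cong (_+ j) (sym (+-suc i k)))
  pascal : ∀ p q f a b j k →
    (p + q) * ((1 + j) * f * (a * ((1 + k) * b))) ≡
    (1 + j) * (p * (f * (a * ((1 + k) * b)))) + (1 + k) * (q * ((1 + j) * f * (a * b)))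
  pascal = solve-∀

data Layer : Set where
  below inside above : Layer

_≟below : (ℓ : Layer) → Dec (ℓ ≡ below)
below  ≟below = yes refl
inside ≟below = no λ ()
above  ≟below = no λ ()

δ : Layer → Layer → ℕ
δ below  below  = 1
δ inside inside = 1
δ above  above  = 1
δ _      _      = 0

count : ∀ {n} → Layer → (Fin n → Layer) → ℕ
count {n} ℓ v = ∑[ k < n ] δ ℓ (v k)

δ-expansion : ∀ (g : Layer → ℕ) ℓ →
  g ℓ ≡ δ below ℓ * g below + δ inside ℓ * g inside + δ above ℓ * g above
δ-expansion g below  = sym (trans (+-identityʳ _) (trans (+-identityʳ _) (+-identityʳ _)))
δ-expansion g inside = sym (trans (+-identityʳ _) (+-identityʳ _))
δ-expansion g above  = sym (+-identityʳ _)

∑-by-layer : ∀ {n} (g : Layer → ℕ) (v : Fin n → Layer) →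
  ∑[ k < n ] g (v k) ≡ count below v * g below + count inside v * g inside + count above v * g above
∑-by-layer {zero}  g v = refl
∑-by-layer {suc n} g v = begin
  g (v zero) + ∑[ k < n ] g (v (suc k))
    ≡⟨ cong₂ _+_ (δ-expansion g (v zero)) (∑-by-layer g (v ∘ suc)) ⟩
  (δ below (v zero) * g below + δ inside (v zero) * g inside + δ above (v zero) * g above)
    + (count below (v ∘ suc) * g below + count inside (v ∘ suc) * g inside + count above (v ∘ suc) * g above)
    ≡⟨ distrib (δ below (v zero)) (δ inside (v zero)) (δ above (v zero))
               (count below (v ∘ suc)) (count inside (v ∘ suc)) (count above (v ∘ suc))
               (g below) (g inside) (g above) ⟩
  count below v * g below + count inside v * g inside + count above v * g above ∎
  where
  open ≡-Reasoning
  distrib : ∀ a b c a′ b′ c′ x y z →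
    (a * x + b * y + c * z) + (a′ * x + b′ * y + c′ * z) ≡ (a + a′) * x + (b + b′) * y + (c + c′) * z
  distrib = solve-∀

count-total : ∀ {n} (v : Fin n → Layer) → count below v + count above v + count inside v ≡ n
count-total {zero}  v = refl
count-total {suc n} v with v zero
... | below  = cong suc (count-total (v ∘ suc))
... | above  = trans (cong (_+ count inside (v ∘ suc)) (+-suc (count below (v ∘ suc)) _))
                     (cong suc (count-total (v ∘ suc)))
... | inside = trans (+-suc (count below (v ∘ suc) + count above (v ∘ suc)) _)
                     (cong suc (count-total (v ∘ suc)))

count-removeAt : ∀ {m} ℓ (v : Fin (suc m) → Layer) p → count ℓ v ≡ δ ℓ (v p) + count ℓ (removeAt v p)
count-removeAt ℓ v p = sum-remove {i = p} (δ ℓ ∘ v)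

count-removeAt-∸ : ∀ {m} ℓ (v : Fin (suc m) → Layer) p → count ℓ (removeAt v p) ≡ count ℓ v ∸ δ ℓ (v p)
count-removeAt-∸ ℓ v p = sym (trans (cong (_∸ δ ℓ (v p)) (count-removeAt ℓ v p)) (m+n∸m≡n (δ ℓ (v p)) _))

chainsThrough : ∀ {n} → (Fin n → Layer) → ℕ
chainsThrough v = chainCount (count below v) (count inside v) (count above v)

chainsThrough≤factorial : ∀ {n} (v : Fin n → Layer) → chainsThrough v ≤ n !
chainsThrough≤factorial v =
  subst (λ m → chainsThrough v ≤ m !) (count-total v)
        (chainCount≤factorial (count below v) (count inside v) (count above v))

chainsThrough-removeAt : ∀ {m} (v : Fin (suc m) → Layer) p →
  chainsThrough (removeAt v p) ≡
  chainCount (count below v ∸ δ below (v p)) (count inside v ∸ δ inside (v p)) (count above v ∸ δ above (v p))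
chainsThrough-removeAt v p = trans
  (cong₂ (λ i j → chainCount i j (count above (removeAt v p)))
         (count-removeAt-∸ below v p) (count-removeAt-∸ inside v p))
  (cong (chainCount (count below v ∸ δ below (v p)) (count inside v ∸ δ inside (v p))) (count-removeAt-∸ above v p))

-- The chains counted by chainsThrough v that add coordinate p last, provided v has an above coordinate
-- (otherwise a below coordinate may come last as well).
chainsEndingAt : ∀ {m} → Fin (suc m) → (Fin (suc m) → Layer) → ℕ
chainsEndingAt p v with v p ≟below
... | yes _ = 0
... | no  _ = chainsThrough (removeAt v p)

∑-chainsEndingAt : ∀ {m} (v : Fin (suc m) → Layer) {q} → v q ≡ above →
  ∑[ p < suc m ] chainsEndingAt p v ≡ chainsThrough v
∑-chainsEndingAt {m} v {q} vq≡above = begin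
  ∑[ p < suc m ] chainsEndingAt p v                                 ≡⟨ sum-cong-≗ chainsEndingAt≡removal ⟩
  ∑[ p < suc m ] removal (v p)                                      ≡⟨ ∑-by-layer removal v ⟩
  i * 0 + j * chainCount i (j ∸ 1) K + K * chainCount i j (K ∸ 1)   ≡⟨ recurrence K≡1+k ⟩
  chainsThrough v                                                   ∎
  where
  open ≡-Reasoning
  i = count below v
  j = count inside v
  K = count above v
  K≡1+k : K ≡ suc (count above (removeAt v q))
  K≡1+k = trans (count-removeAt above v q) (cong (λ ℓ → δ above ℓ + count above (removeAt v q)) vq≡above)
  recurrence : ∀ {K k} → K ≡ suc k →
    i * 0 + j * chainCount i (j ∸ 1) K + K * chainCount i j (K ∸ 1) ≡ chainCount i j K
  recurrence {k = k} refl =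
    trans (cong (λ x → x + j * chainCount i (j ∸ 1) (suc k) + suc k * chainCount i j k) (*-zeroʳ i))
          (sym (chainCount-recurrence i j k))
  removal : Layer → ℕ
  removal below = 0
  removal ℓ     = chainCount (i ∸ δ below ℓ) (j ∸ δ inside ℓ) (K ∸ δ above ℓ)
  removal-notBelow : ∀ {ℓ} → ℓ ≢ below →
    chainCount (i ∸ δ below ℓ) (j ∸ δ inside ℓ) (K ∸ δ above ℓ) ≡ removal ℓ
  removal-notBelow {below}  ℓ≢below = contradiction refl ℓ≢below
  removal-notBelow {inside} _       = refl
  removal-notBelow {above}  _       = refl
  chainsEndingAt≡removal : ∀ p → chainsEndingAt p v ≡ removal (v p)
  chainsEndingAt≡removal p with v p ≟below
  ... | yes vp≡below = sym (cong removal vp≡below)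
  ... | no  vp≢below = trans (chainsThrough-removeAt v p) (removal-notBelow vp≢below)

BelowAbove : ∀ {n} → (Fin n → Layer) → (Fin n → Layer) → Set
BelowAbove u v = ∃ λ k → u k ≡ below × v k ≡ above

-- No ordering of the coordinates is counted by both chainsThrough u and chainsThrough v.
Crossing : ∀ {n} → (Fin n → Layer) → (Fin n → Layer) → Set
Crossing u v = BelowAbove u v × BelowAbove v u

belowAbove-removeAt : ∀ {m} {u v : Fin (suc m) → Layer} {p} → u p ≢ below →
  BelowAbove u v → BelowAbove (removeAt u p) (removeAt v p)
belowAbove-removeAt {u = u} {v} {p} up≢below (k , uk≡below , vk≡above) =
  punchOut p≢k , trans (cong u (punchIn-punchOut p≢k)) uk≡below , trans (cong v (punchIn-punchOut p≢k)) vk≡above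
  where
  p≢k : p ≢ k
  p≢k refl = up≢below uk≡below

crossing-removeAt : ∀ {m} {u v : Fin (suc m) → Layer} {p} → u p ≢ below → v p ≢ below →
  Crossing u v → Crossing (removeAt u p) (removeAt v p)
crossing-removeAt up≢below vp≢below (uv , vu) = belowAbove-removeAt up≢below uv , belowAbove-removeAt vp≢below vu

dropCoordinate : ∀ {m} → Fin (suc m) → List (Fin (suc m) → Layer) → List (Fin m → Layer)
dropCoordinate p []       = []
dropCoordinate p (v ∷ vs) with v p ≟below
... | yes _ = dropCoordinate p vs
... | no  _ = removeAt v p ∷ dropCoordinate p vs

sum-dropCoordinate : ∀ {m} (p : Fin (suc m)) vs →
  sum (map chainsThrough (dropCoordinate p vs)) ≡ sum (map (chainsEndingAt p) vs)
sum-dropCoordinate p []       = refl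
sum-dropCoordinate p (v ∷ vs) with v p ≟below
... | yes _ = sum-dropCoordinate p vs
... | no  _ = cong (_+_ (chainsThrough (removeAt v p))) (sum-dropCoordinate p vs)

dropCoordinate-crossing : ∀ {m} (p : Fin (suc m)) {u} vs → u p ≢ below →
  All (Crossing u) vs → All (Crossing (removeAt u p)) (dropCoordinate p vs)
dropCoordinate-crossing p []       up≢below []       = []
dropCoordinate-crossing p (v ∷ vs) up≢below (c ∷ cs) with v p ≟below
... | yes _        = dropCoordinate-crossing p vs up≢below cs
... | no  vp≢below = crossing-removeAt up≢below vp≢below c ∷ dropCoordinate-crossing p vs up≢below cs

dropCoordinate-pairwise : ∀ {m} (p : Fin (suc m)) vs → AllPairs Crossing vs → AllPairs Crossing (dropCoordinate p vs)
dropCoordinate-pairwise p []       []         = []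
dropCoordinate-pairwise p (v ∷ vs) (cs ∷ css) with v p ≟below
... | yes _        = dropCoordinate-pairwise p vs css
... | no  vp≢below = dropCoordinate-crossing p vs vp≢below cs ∷ dropCoordinate-pairwise p vs css

-- From two vectors on, each has an above coordinate (as ∑-chainsEndingAt requires), by crossing another.
sum-chainsThrough≤factorial : ∀ n (vs : List (Fin n → Layer)) → AllPairs Crossing vs →
  sum (map chainsThrough vs) ≤ n !
sum-chainsThrough≤factorial n       []       _ = z≤n
sum-chainsThrough≤factorial n       (v ∷ []) _ = subst (_≤ n !) (sym (+-identityʳ _)) (chainsThrough≤factorial v)
sum-chainsThrough≤factorial zero    (_ ∷ _ ∷ _) ((((() , _) , _) ∷ _) ∷ _)
sum-chainsThrough≤factorial (suc m) vs@(u ∷ v ∷ ws)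
  pairwise@((((_ , _ , v-above) , (_ , _ , u-above)) ∷ u-crossings) ∷ _) = begin
  sum (map chainsThrough vs)
    ≡⟨ cong sum (map-cong-local lastCoordinate) ⟨
  sum (map (λ w → ∑[ p < suc m ] chainsEndingAt p w) vs)
    ≡⟨ sum-∑-comm chainsEndingAt vs ⟩
  ∑[ p < suc m ] sum (map (chainsEndingAt p) vs)
    ≡⟨ sum-cong-≗ (λ p → sum-dropCoordinate p vs) ⟨
  ∑[ p < suc m ] sum (map chainsThrough (dropCoordinate p vs))
    ≤⟨ ∑-≤-* (λ p → sum-chainsThrough≤factorial m _ (dropCoordinate-pairwise p vs pairwise)) ⟩
  suc m * m ! ∎
  where
  open ≤-Reasoning
  lastCoordinate : All (λ w → ∑[ p < suc m ] chainsEndingAt p w ≡ chainsThrough w) vs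
  lastCoordinate = ∑-chainsEndingAt u u-above ∷ ∑-chainsEndingAt v v-above
                 ∷ All.map (λ {w} ((_ , _ , w-above) , _) → ∑-chainsEndingAt w w-above) u-crossings

layer : Bool → Bool → Layer
layer true  _     = below
layer false true  = inside
layer false false = above

layers : ∀ {n} → Subset n → Subset n → Fin n → Layer
layers X Y k = layer (lookup X k) (lookup Y k)

count-below-layers : ∀ {n} (X Y : Subset n) → count below (layers X Y) ≡ ∣ X ∣
count-below-layers []          []          = refl
count-below-layers (true  ∷ X) (_     ∷ Y) = cong suc (count-below-layers X Y)
count-below-layers (false ∷ X) (true  ∷ Y) = count-below-layers X Y
count-below-layers (false ∷ X) (false ∷ Y) = count-below-layers X Y

count-below+inside-layers : ∀ {n} {X Y : Subset n} → X ⊆ Y →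
  count below (layers X Y) + count inside (layers X Y) ≡ ∣ Y ∣
count-below+inside-layers {X = []}        {[]}        _   = refl
count-below+inside-layers {X = true  ∷ X} {true  ∷ Y} X⊆Y = cong suc (count-below+inside-layers (drop-∷-⊆ X⊆Y))
count-below+inside-layers {X = true  ∷ X} {false ∷ Y} X⊆Y with () ← X⊆Y here
count-below+inside-layers {X = false ∷ X} {true  ∷ Y} X⊆Y =
  trans (+-suc _ _) (cong suc (count-below+inside-layers (drop-∷-⊆ X⊆Y)))
count-below+inside-layers {X = false ∷ X} {false ∷ Y} X⊆Y = count-below+inside-layers (drop-∷-⊆ X⊆Y)

diamondChains : ℕ → ℕ → ℕ → ℕ
diamondChains n i j = chainCount i j (n ∸ j ∸ i)

chainsThrough-layers : ∀ {n} {X Y : Subset n} {i j} → X ⊆ Y → ∣ X ∣ ≡ i → ∣ Y ∣ ≡ i + j →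
  chainsThrough (layers X Y) ≡ diamondChains n i j
chainsThrough-layers {n} {X} {Y} {i} {j} X⊆Y |X|≡i |Y|≡i+j = begin
  chainCount lo mid hi        ≡⟨ cong₂ (λ x y → chainCount x y hi) lo≡i mid≡j ⟩
  chainCount i j hi           ≡⟨ cong (chainCount i j) hi≡n∸j∸i ⟩
  chainCount i j (n ∸ j ∸ i)  ∎
  where
  open ≡-Reasoning
  lo  = count below (layers X Y)
  mid = count inside (layers X Y)
  hi  = count above (layers X Y)
  lo≡i : lo ≡ i
  lo≡i = trans (count-below-layers X Y) |X|≡i
  mid≡j : mid ≡ j
  mid≡j = +-cancelˡ-≡ i mid j (trans (cong (_+ mid) (sym lo≡i)) (trans (count-below+inside-layers X⊆Y) |Y|≡i+j))
  hi≡n∸j∸i : hi ≡ n ∸ j ∸ i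
  hi≡n∸j∸i = begin
    hi                        ≡⟨ m+n∸m≡n lo hi ⟨
    lo + hi ∸ lo              ≡⟨ cong (_∸ lo) (m+n∸n≡m (lo + hi) mid) ⟨
    lo + hi + mid ∸ mid ∸ lo  ≡⟨ cong (λ t → t ∸ mid ∸ lo) (count-total (layers X Y)) ⟩
    n ∸ mid ∸ lo              ≡⟨ cong₂ (λ x y → n ∸ x ∸ y) mid≡j lo≡i ⟩
    n ∸ j ∸ i                 ∎

binomial*diamondChains : ∀ {n i j} → i + j ≤ n → ((n ∸ j) C i) * diamondChains n i j ≡ n !
binomial*diamondChains {n} {i} {j} i+j≤n = begin
  ((n ∸ j) C i) * chainCount i j k  ≡⟨ *-comm ((n ∸ j) C i) _ ⟩
  chainCount i j k * ((n ∸ j) C i)  ≡⟨ cong (λ x → chainCount i j k * (x C i)) i+k≡n∸j ⟨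
  chainCount i j k * ((i + k) C i)  ≡⟨ chainCount*binomial i j k ⟩
  (i + k + j) !                     ≡⟨ cong (λ x → (x + j) !) i+k≡n∸j ⟩
  (n ∸ j + j) !                     ≡⟨ cong _! (m∸n+n≡m (m+n≤o⇒n≤o i i+j≤n)) ⟩
  n !                               ∎
  where
  open ≡-Reasoning
  k = n ∸ j ∸ i
  i+k≡n∸j : i + k ≡ n ∸ j
  i+k≡n∸j = m+[n∸m]≡n (m+n≤o⇒m≤o∸n i i+j≤n)

⊈⇒∃∉ : ∀ {n} {X Y : Subset n} → ¬ X ⊆ Y → ∃ λ k → k Subset.∈ X × k Subset.∉ Y
⊈⇒∃∉ {n} {X} {Y} X⊈Y
  with ¬∀⟶∃¬ n (λ k → k Subset.∈ X → k Subset.∈ Y) (λ k → k ∈? X →-dec k ∈? Y) (λ X⊆Y → X⊈Y (X⊆Y _))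
... | k , k∈X↛k∈Y with k ∈? X
...   | yes k∈X = k , k∈X , λ k∈Y → k∈X↛k∈Y (λ _ → k∈Y)
...   | no  k∉X = contradiction (λ k∈X → contradiction k∈X k∉X) k∈X↛k∈Y

∉⇒lookup≡false : ∀ {n} {k : Fin n} {X} → k Subset.∉ X → lookup X k ≡ false
∉⇒lookup≡false {k = k} {X} k∉X = Bool.¬-not (k∉X ∘ lookup⇒[]= k X)

belowAbove-layers : ∀ {n} {X Y X′ Y′ : Subset n} → X′ ⊆ Y′ → ¬ X ⊆ Y′ →
  BelowAbove (layers X Y) (layers X′ Y′)
belowAbove-layers {Y = Y} X′⊆Y′ X⊈Y′ with ⊈⇒∃∉ X⊈Y′
... | k , k∈X , k∉Y′ =
  k , cong (λ x → layer x (lookup Y k)) ([]=⇒lookup k∈X) ,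
      cong₂ layer (∉⇒lookup≡false (k∉Y′ ∘ X′⊆Y′)) (∉⇒lookup≡false k∉Y′)

diamond-corners-unique : ∀ {n} {X Y X′ Y′ : Subset n} → X ⊆ Y → X′ ⊆ Y′ →
  (∀ {Z} → InDiamond X Y Z → InDiamond X′ Y′ Z) → (∀ {Z} → InDiamond X′ Y′ Z → InDiamond X Y Z) →
  (X , Y) ≡ (X′ , Y′)
diamond-corners-unique X⊆Y X′⊆Y′ D⊆D′ D′⊆D = cong₂ _,_
  (⊆-antisym (proj₁ (D′⊆D (⊆-refl , X′⊆Y′))) (proj₁ (D⊆D′ (⊆-refl , X⊆Y))))
  (⊆-antisym (proj₂ (D⊆D′ (X⊆Y , ⊆-refl))) (proj₂ (D′⊆D (X′⊆Y′ , ⊆-refl))))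

module _ {n} (F : Family n) where

  Adj-sym : ∀ {A B} → Adj F A B → Adj F B A
  Adj-sym (FA , FB , A≢B , A⊆B⊎B⊆A) = FB , FA , A≢B ∘ sym , ⊎-swap A⊆B⊎B⊆A

  ⊆⇒connected : ∀ {A B} → F A → F B → A ⊆ B → Star (Adj F) A B
  ⊆⇒connected {A} {B} FA FB A⊆B with ≡-dec Bool._≟_ A B
  ... | yes refl = ε
  ... | no  A≢B  = (FA , FB , A≢B , inj₁ A⊆B) ◅ ε

  component-diamond-⊆ : ∀ {A B X Y X′ Y′} → ComponentIsDiamond F A X Y → ComponentIsDiamond F B X′ Y′ →
    F B → Star (Adj F) B A → ∀ {Z} → InDiamond X Y Z → InDiamond X′ Y′ Z
  component-diamond-⊆ (_ , A≅XY) (_ , B≅X′Y′) FB B→A Z∈XY with Equivalence.from (A≅XY _) Z∈XY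
  ... | _ , FZ , A→Z = Equivalence.to (B≅X′Y′ _) (FB , FZ , B→A ◅◅ A→Z)

  -- X ⊆ Y′ joins X and Y′ by an edge (or they are equal), so the two components coincide.
  corners-⊆⇒≡ : ∀ {X Y X′ Y′} → IsComponentCorners F X Y → IsComponentCorners F X′ Y′ → X ⊆ Y′ →
    (X , Y) ≡ (X′ , Y′)
  corners-⊆⇒≡ (A , FA , D@(X⊆Y , A≅XY)) (A′ , FA′ , D′@(X′⊆Y′ , A′≅X′Y′)) X⊆Y′
    with Equivalence.from (A≅XY _) (⊆-refl , X⊆Y) | Equivalence.from (A′≅X′Y′ _) (X′⊆Y′ , ⊆-refl)
  ... | _ , FX , A→X | _ , FY′ , A′→Y′ =
    diamond-corners-unique X⊆Y X′⊆Y′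
      (component-diamond-⊆ D D′ FA′ (reverse Adj-sym A→A′)) (component-diamond-⊆ D′ D FA A→A′)
    where
    A→A′ : Star (Adj F) A A′
    A→A′ = A→X ◅◅ ⊆⇒connected FX FY′ X⊆Y′ ◅◅ reverse Adj-sym A′→Y′

  corners-crossing : ∀ {X Y X′ Y′} → IsComponentCorners F X Y → IsComponentCorners F X′ Y′ →
    (X , Y) ≢ (X′ , Y′) → Crossing (layers X Y) (layers X′ Y′)
  corners-crossing {Y = Y} {Y′ = Y′} c@(_ , _ , X⊆Y , _) c′@(_ , _ , X′⊆Y′ , _) XY≢X′Y′ =
    belowAbove-layers {Y = Y} X′⊆Y′ (XY≢X′Y′ ∘ corners-⊆⇒≡ c c′) ,
    belowAbove-layers {Y = Y′} X⊆Y (XY≢X′Y′ ∘ sym ∘ corners-⊆⇒≡ c′ c)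

sumℕ : ℕ → (ℕ → ℕ) → ℕ
sumℕ n f = sum (map f (upTo (suc n)))

sumℕ-cong : ∀ n {f g : ℕ → ℕ} → (∀ i → f i ≡ g i) → sumℕ n f ≡ sumℕ n g
sumℕ-cong n f≗g = cong sum (map-cong f≗g (upTo (suc n)))

sumℕ-+ : ∀ n (f g : ℕ → ℕ) → sumℕ n (λ i → f i + g i) ≡ sumℕ n f + sumℕ n g
sumℕ-+ n f g = sum-map-+ f g (upTo (suc n))

sumℕ-zero : ∀ n {f : ℕ → ℕ} → (∀ i → f i ≡ 0) → sumℕ n f ≡ 0
sumℕ-zero n {f} f≡0 = trans (cong sum (map-applyUpTo id f (suc n))) (sum-applyUpTo-zero (suc n) f≡0)

sumℕ-single : ∀ n {f : ℕ → ℕ} {i₀} → i₀ ≤ n → (∀ i → i ≢ i₀ → f i ≡ 0) → sumℕ n f ≡ f i₀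
sumℕ-single n {f} i₀≤n vanish =
  trans (cong sum (map-applyUpTo id f (suc n))) (sum-applyUpTo-single (suc n) (s≤s i₀≤n) vanish)

hasType? : ∀ {n} i j (p : Subset n × Subset n) → Dec (∣ proj₁ p ∣ ≡ i × ∣ proj₂ p ∣ ≡ i + j)
hasType? i j (X , Y) = (∣ X ∣ ≟ i) ×-dec (∣ Y ∣ ≟ i + j)

a-∷ : ∀ {n} p (L : List (Subset n × Subset n)) i j → a (p ∷ L) i j ≡ a [ p ] i j + a L i j
a-∷ p L i j = trans (cong length (filter-++ (hasType? i j) [ p ] L)) (length-++ (filter (hasType? i j) [ p ]))

a-single : ∀ {n} (X Y : Subset n) {i j} → ∣ X ∣ ≡ i → ∣ Y ∣ ≡ i + j → a [ (X , Y) ] i j ≡ 1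
a-single X Y {i} {j} |X|≡i |Y|≡i+j = cong length (filter-accept (hasType? i j) {X , Y} (|X|≡i , |Y|≡i+j))

a-single-other : ∀ {n} (X Y : Subset n) i j → ¬ (∣ X ∣ ≡ i × ∣ Y ∣ ≡ i + j) → a [ (X , Y) ] i j ≡ 0
a-single-other X Y i j ¬type = cong length (filter-reject (hasType? i j) {X , Y} ¬type)

a-out-of-range : ∀ {n} (L : List (Subset n × Subset n)) {i j} → ¬ i + j ≤ n → a L i j ≡ 0
a-out-of-range L {i} {j} i+j≰n = cong length (filter-none (hasType? i j)
  (All.universal (λ (_ , Y) (_ , |Y|≡i+j) → i+j≰n (subst (_≤ _) |Y|≡i+j (∣p∣≤n Y))) L))

totalChains : ∀ {n} → List (Subset n × Subset n) → ℕ
totalChains {n} L = sumℕ n (λ i → sumℕ n (λ j → a L i j * diamondChains n i j))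

totalChains-single : ∀ {n} {X Y : Subset n} → X ⊆ Y → totalChains [ (X , Y) ] ≡ chainsThrough (layers X Y)
totalChains-single {n} {X} {Y} X⊆Y = begin
  sumℕ n (λ i → sumℕ n (λ j → a [ (X , Y) ] i j * diamondChains n i j))
    ≡⟨ sumℕ-single n (∣p∣≤n X) (λ i i≢i₀ → sumℕ-zero n (λ j → cong (_* diamondChains n i j)
                                  (a-single-other X Y i j (i≢i₀ ∘ sym ∘ proj₁)))) ⟩
  sumℕ n (λ j → a [ (X , Y) ] i₀ j * diamondChains n i₀ j)
    ≡⟨ sumℕ-single n (≤-trans (m∸n≤m ∣ Y ∣ i₀) (∣p∣≤n Y)) (λ j j≢j₀ → cong (_* diamondChains n i₀ j)
                                  (a-single-other X Y i₀ j (j≢j₀ ∘ j≡j₀ j ∘ proj₂))) ⟩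
  a [ (X , Y) ] i₀ j₀ * diamondChains n i₀ j₀
    ≡⟨ cong (_* diamondChains n i₀ j₀) (a-single X Y refl |Y|≡i₀+j₀) ⟩
  1 * diamondChains n i₀ j₀
    ≡⟨ *-identityˡ _ ⟩
  diamondChains n i₀ j₀
    ≡⟨ chainsThrough-layers X⊆Y refl |Y|≡i₀+j₀ ⟨
  chainsThrough (layers X Y) ∎
  where
  open ≡-Reasoning
  i₀ = ∣ X ∣
  j₀ = ∣ Y ∣ ∸ i₀
  |Y|≡i₀+j₀ : ∣ Y ∣ ≡ i₀ + j₀
  |Y|≡i₀+j₀ = sym (m+[n∸m]≡n (p⊆q⇒∣p∣≤∣q∣ X⊆Y))
  j≡j₀ : ∀ j → ∣ Y ∣ ≡ i₀ + j → j ≡ j₀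
  j≡j₀ j |Y|≡i₀+j = sym (trans (cong (_∸ i₀) |Y|≡i₀+j) (m+n∸m≡n i₀ j))

totalChains≡sum-chainsThrough : ∀ {n} (L : List (Subset n × Subset n)) → All (uncurry _⊆_) L →
  totalChains L ≡ sum (map (chainsThrough ∘ uncurry layers) L)
totalChains≡sum-chainsThrough {n} []                [] = sumℕ-zero n (λ i → sumℕ-zero n (λ j → refl))
totalChains≡sum-chainsThrough {n} (p@(X , Y) ∷ L) (X⊆Y ∷ ⊆s) = begin
  sumℕ n (λ i → sumℕ n (λ j → a (p ∷ L) i j * w i j))
    ≡⟨ sumℕ-cong n (λ i → sumℕ-cong n (λ j →
         trans (cong (_* w i j) (a-∷ p L i j)) (*-distribʳ-+ (w i j) (a [ p ] i j) (a L i j)))) ⟩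
  sumℕ n (λ i → sumℕ n (λ j → a [ p ] i j * w i j + a L i j * w i j))
    ≡⟨ sumℕ-cong n (λ i → sumℕ-+ n (λ j → a [ p ] i j * w i j) (λ j → a L i j * w i j)) ⟩
  sumℕ n (λ i → sumℕ n (λ j → a [ p ] i j * w i j) + sumℕ n (λ j → a L i j * w i j))
    ≡⟨ sumℕ-+ n (λ i → sumℕ n (λ j → a [ p ] i j * w i j)) (λ i → sumℕ n (λ j → a L i j * w i j)) ⟩
  totalChains [ p ] + totalChains L
    ≡⟨ cong₂ _+_ (totalChains-single X⊆Y) (totalChains≡sum-chainsThrough L ⊆s) ⟩
  chainsThrough (layers X Y) + sum (map (chainsThrough ∘ uncurry layers) L) ∎
  where
  open ≡-Reasoning
  w = diamondChains n

totalChains≤factorial : ∀ {n} (F : Family n) (L : List (Subset n × Subset n)) →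
  All (uncurry (IsComponentCorners F)) L → Unique L → totalChains L ≤ n !
totalChains≤factorial {n} F L corners unique = begin
  totalChains L
    ≡⟨ totalChains≡sum-chainsThrough L (All.map (proj₁ ∘ proj₂ ∘ proj₂) corners) ⟩
  sum (map (chainsThrough ∘ uncurry layers) L)
    ≡⟨ cong sum (map-∘ L) ⟩
  sum (map chainsThrough (map (uncurry layers) L))
    ≤⟨ sum-chainsThrough≤factorial n _ (map⁺ (AllPairs-map-All (corners-crossing F) corners unique)) ⟩
  n ! ∎
  where open ≤-Reasoning

toℚᵘ-/ : ∀ m d → toℚᵘ (+ m / suc d) ℚᵘ.≃ mkℚᵘ (+ m) d
toℚᵘ-/ m d = ℚ.toℚᵘ-fromℚᵘ (mkℚᵘ (+ m) d)

/-+ : ∀ m n N .{{_ : NonZero N}} → + m / N ℚ.+ + n / N ≡ + (m + n) / N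
/-+ m n (suc d) = ℚ.toℚᵘ-injective (begin
  toℚᵘ (+ m / suc d ℚ.+ + n / suc d)          ≈⟨ ℚ.toℚᵘ-homo-+ (+ m / suc d) (+ n / suc d) ⟩
  toℚᵘ (+ m / suc d) ℚᵘ.+ toℚᵘ (+ n / suc d)  ≈⟨ ℚᵘ.+-cong (toℚᵘ-/ m d) (toℚᵘ-/ n d) ⟩
  mkℚᵘ (+ m) d ℚᵘ.+ mkℚᵘ (+ n) d              ≈⟨ *≡* cross-multiplied ⟩
  mkℚᵘ (+ (m + n)) d                          ≈⟨ toℚᵘ-/ (m + n) d ⟨
  toℚᵘ (+ (m + n) / suc d)                    ∎)
  where
  open ℚᵘ.≃-Reasoning
  distrib : ∀ (x y z : ℤ) → (x ℤ.* z ℤ.+ y ℤ.* z) ℤ.* z ≡ (x ℤ.+ y) ℤ.* (z ℤ.* z)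
  distrib = ℤ-solve-∀
  cross-multiplied : (+ m ℤ.* + suc d ℤ.+ + n ℤ.* + suc d) ℤ.* + suc d ≡ + (m + n) ℤ.* (+ suc d ℤ.* + suc d)
  cross-multiplied = trans (distrib (+ m) (+ n) (+ suc d)) (cong (ℤ._* (+ suc d ℤ.* + suc d)) (sym (ℤ.pos-+ m n)))

/≤1 : ∀ {m N} .{{_ : NonZero N}} → m ≤ N → + m / N ℚ.≤ 1ℚ
/≤1 {m} {suc d} m≤N =
  ℚ.toℚᵘ-cancel-≤ (ℚᵘ.≤-respˡ-≃ (ℚᵘ.≃-sym (toℚᵘ-/ m d)) (*≤* m*1≤1*N))
  where
  m*1≤1*N : + m ℤ.* + 1 ℤ.≤ + 1 ℤ.* + suc d
  m*1≤1*N = subst₂ ℤ._≤_ (ℤ.pos-* m 1) (ℤ.pos-* 1 (suc d))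
              (ℤ.+≤+ (subst₂ _≤_ (sym (*-identityʳ m)) (sym (*-identityˡ (suc d))) m≤N))

frac-scale : ∀ {c w N} .{{_ : NonZero N}} k → c * w ≡ N → frac k c ≡ + (k * w) / N
frac-scale {zero}        {N = suc _} k ()
frac-scale {suc c} {w} {suc d}      k c*w≡N = ℚ.fromℚᵘ-cong {mkℚᵘ (+ k) c} {mkℚᵘ (+ (k * w)) d}
  (*≡* (trans (sym (ℤ.pos-* k (suc d))) (trans (cong +_ k*N≡k*w*c) (ℤ.pos-* (k * w) (suc c)))))
  where
  rearrange : ∀ k c w → k * (c * w) ≡ k * w * c
  rearrange = solve-∀
  k*N≡k*w*c : k * suc d ≡ k * w * suc c
  k*N≡k*w*c = trans (cong (k *_) (sym c*w≡N)) (rearrange k (suc c) w)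

frac-zero : ∀ c N .{{_ : NonZero N}} → frac 0 c ≡ + 0 / N
frac-zero zero    N = sym (ℚ.0/n≡0 N)
frac-zero (suc c) N = trans (ℚ.0/n≡0 (suc c)) (sym (ℚ.0/n≡0 N))

sumℚ-cong : ∀ n {f g : ℕ → ℚ} → (∀ i → f i ≡ g i) → sumℚ n f ≡ sumℚ n g
sumℚ-cong n f≗g = cong (foldr ℚ._+_ 0ℚ) (map-cong f≗g (upTo (suc n)))

foldr-/ : ∀ N .{{_ : NonZero N}} (f : ℕ → ℕ) xs →
  foldr ℚ._+_ 0ℚ (map (λ i → + f i / N) xs) ≡ + sum (map f xs) / N
foldr-/ N f []       = sym (ℚ.0/n≡0 N)
foldr-/ N f (x ∷ xs) = trans (cong (+ f x / N ℚ.+_) (foldr-/ N f xs)) (/-+ (f x) (sum (map f xs)) N)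

sumℚ-/ : ∀ n N .{{_ : NonZero N}} (f : ℕ → ℕ) → sumℚ n (λ i → + f i / N) ≡ + sumℕ n f / N
sumℚ-/ n N f = foldr-/ N f (upTo (suc n))

module _ {n : ℕ} where
  private instance
    n!≢0 : NonZero (n !)
    n!≢0 = n !≢0

  frac-a : ∀ (L : List (Subset n × Subset n)) i j →
    frac (a L i j) ((n ∸ j) C i) ≡ + (a L i j * diamondChains n i j) / n !
  frac-a L i j with i + j ≤? n
  ... | yes i+j≤n = frac-scale {(n ∸ j) C i} (a L i j) (binomial*diamondChains {n} {i} {j} i+j≤n)
  ... | no  i+j≰n = subst (λ x → frac x ((n ∸ j) C i) ≡ + (x * diamondChains n i j) / n !)
                          (sym (a-out-of-range L i+j≰n)) (frac-zero ((n ∸ j) C i) (n !))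

  lhs≡totalChains/n! : ∀ (L : List (Subset n × Subset n)) → lhs L ≡ + totalChains L / n !
  lhs≡totalChains/n! L = begin
    sumℚ n (λ i → sumℚ n (λ j → frac (a L i j) ((n ∸ j) C i)))
      ≡⟨ sumℚ-cong n (λ i → sumℚ-cong n (frac-a L i)) ⟩
    sumℚ n (λ i → sumℚ n (λ j → + (a L i j * diamondChains n i j) / n !))
      ≡⟨ sumℚ-cong n (λ i → sumℚ-/ n (n !) (λ j → a L i j * diamondChains n i j)) ⟩
    sumℚ n (λ i → + sumℕ n (λ j → a L i j * diamondChains n i j) / n !)
      ≡⟨ sumℚ-/ n (n !) (λ i → sumℕ n (λ j → a L i j * diamondChains n i j)) ⟩
    + totalChains L / n ! ∎
    where open ≡-Reasoning

-- Only the listed components matter.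
theorem3p1 : (n : ℕ) (F : Family n) → AllComponentsDiamonds F →
    (L : List (Subset n × Subset n)) → Unique L →
    (∀ X Y → ((X , Y) ∈ L) ⇔ IsComponentCorners F X Y) →
    lhs L ℚ.≤ 1ℚ
theorem3p1 n F _ L unique L-corners = begin
  lhs L                  ≡⟨ lhs≡totalChains/n! L ⟩
  + totalChains L / n !  ≤⟨ /≤1 (totalChains≤factorial F L corners unique) ⟩
  1ℚ                     ∎
  where
  open ℚ.≤-Reasoning
  instance _ = n !≢0
  corners : All (uncurry (IsComponentCorners F)) L
  corners = All.tabulate (λ {(X , Y)} → Equivalence.to (L-corners X Y))
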